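{- Let $s > r \ge 2$, let $c = \frac{1}{4r^2}$, and let $G=(V,E)$ be an $n$-vertex $K_s$-saturated graph with at most $\mathrm{sat}(n,K_r,K_s) + cn$ copies of $K_r$. Let $E_1$ be the set of edges of $G$ contained in at least one copy of $K_r$, $E_2 = E\setminus E_1$, $G_1=(V,E_1)$, $A = \{v \in V : d_{G_1}(v) \le n^{1/3}\}$, $B$ the set of vertices $v \in A$ for which there exist $a_1,\dots,a_{s-2} \in V\setminus A$ such that $v,a_1,\dots,a_{s-2}$ induce a copy of $K_{s-1}$, and $C = \{v \in B : d_{G_1}(v) > s-2\}$. Then no vertex of $B \setminus C$ is incident to an edge of $E_2$.
   Context: A graph $G$ is $K_s$-saturated if $G$ contains no copy of $K_s$ but adding any edge to $G$ creates a copy of $K_s$. $\mathrm{sat}(n,K_r,K_s)$ is the minimum number of copies of $K_r$ in an $n$-vertex $K_s$-saturated graph. $d_H(v)$ is the degree of $v$ in $H$. -}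

module Defs where

open import Data.Bool using (Bool; true; false; _∧_; _∨_; not; if_then_else_)
open import Data.Nat using (ℕ; zero; suc; _≡ᵇ_; _≤_)
open import Data.Fin using (Fin; _≟_)
open import Data.Fin.Subset using (Subset; ∣_∣)
open import Data.List using (List; []; _∷_; map; _++_; length; filterᵇ; allFin)
open import Data.Bool.ListAction using (all; any)
open import Data.Vec using (Vec; lookup) renaming ([] to []ᵥ; _∷_ to _∷ᵥ_)
open import Data.Product using (Σ; _×_)
open import Relation.Nullary using (¬_; does)
open import Relation.Binary.PropositionalEquality using (_≡_; _≢_)

Adj : ℕ → Set
Adj n = Fin n → Fin n → Bool

record SimpleGraph (n : ℕ) : Set where
  field
    adj    : Adj n
    sym    : ∀ i j → adj i j ≡ adj j i
    irrefl : ∀ i → adj i i ≡ false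
open SimpleGraph public

_==_ : ∀ {n} → Fin n → Fin n → Bool
i == j = does (i ≟ j)

allSubsets : (n : ℕ) → List (Subset n)
allSubsets zero    = []ᵥ ∷ []
allSubsets (suc n) = map (false ∷ᵥ_) (allSubsets n) ++ map (true ∷ᵥ_) (allSubsets n)

isCliqueᵇ : ∀ {n} → Adj n → Subset n → Bool
isCliqueᵇ {n} a S =
  all (λ i → all (λ j → not (lookup S i ∧ lookup S j ∧ not (i == j)) ∨ a i j) (allFin n)) (allFin n)

isKᵇ : ∀ {n} → Adj n → ℕ → Subset n → Bool
isKᵇ a k S = isCliqueᵇ a S ∧ (∣ S ∣ ≡ᵇ k)

copiesList : ∀ {n} → Adj n → ℕ → List (Subset n)
copiesList {n} a k = filterᵇ (isKᵇ a k) (allSubsets n)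

copies : ∀ {n} → Adj n → ℕ → ℕ
copies a k = length (copiesList a k)

HasK : ∀ {n} → Adj n → ℕ → Set
HasK {n} a k = Σ (Subset n) λ S → isKᵇ a k S ≡ true

addEdge : ∀ {n} → Adj n → Fin n → Fin n → Adj n
addEdge a u v i j = a i j ∨ ((i == u) ∧ (j == v)) ∨ ((i == v) ∧ (j == u))

Saturated : ∀ {n} → SimpleGraph n → ℕ → Set
Saturated G s =
  (¬ HasK (adj G) s) ×
  (∀ u v → u ≢ v → adj G u v ≡ false → HasK (addEdge (adj G) u v) s)

-- m = sat(n, K_r, K_s): m is attained by some n-vertex K_s-saturated graph
-- and is at most the number of K_r's in every such graph.
IsSat : (n r s m : ℕ) → Set
IsSat n r s m =
  (Σ (SimpleGraph n) λ H → Saturated H s × copies (adj H) r ≡ m) ×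
  (∀ (H : SimpleGraph n) → Saturated H s → m ≤ copies (adj H) r)

inE1ᵇ : ∀ {n} → SimpleGraph n → ℕ → Fin n → Fin n → Bool
inE1ᵇ G r u v = adj G u v ∧ any (λ S → lookup S u ∧ lookup S v) (copiesList (adj G) r)

deg1 : ∀ {n} → SimpleGraph n → ℕ → Fin n → ℕ
deg1 {n} G r v = length (filterᵇ (λ u → inE1ᵇ G r u v) (allFin n))

-- Write s = k + 2 and A = {a₁, …, a_k}; then {v} ∪ A is a K_{k+1}, so every edge from v to A
-- lies in E₁.  A non-neighbour w of v is adjacent to all of A: adding vw creates a K_s, whose other
-- k vertices are joined to v by edges of E₁, and an a_i missed by w would be a (k+1)-st E₁-neighbour
-- of v.  Now let vu be an edge.  If u sees all of A then {u, v} ∪ A is a K_s, so u misses some a_j,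
-- and adding u a_j gives a k-clique Q in the common neighbourhood of u and a_j.  If v ∈ Q, or if at
-- least r − 2 vertices of Q are adjacent to v, then vu lies in a K_r.  Otherwise at least two
-- vertices of Q are non-neighbours of v; they see all of A and together with A form a K_s.
module Submission where

open import Defs hiding (sym)
open import Data.Nat using (ℕ; zero; suc; _+_; _*_; _∸_; _^_; _≤_; _<_; z≤n; s≤s; _≤?_)
open import Data.Nat.Properties using (+-suc; ≤-trans; ≤-reflexive; ≤-pred; ≰⇒>; suc-injective; ≡⇒≡ᵇ; ≡ᵇ⇒≡; +-comm; +-cancelˡ-≤; +-monoʳ-≤; 1+n≰n)
open import Data.Fin using (Fin; zero; suc; _≟_)
open import Data.Fin.Properties using (all?; ¬∀⟶∃¬)
import Data.Fin.Properties as Fin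
open import Data.Fin.Subset using (Subset; ∣_∣; _∈_; _∉_; _⊆_; ⁅_⁆; _∪_; _∩_; ∁; _-_; ⊥; Lift)
open import Data.Fin.Subset.Properties
  using (x∈⁅x⁆; x∈⁅y⁆⇒x≡y; ∉⊥; ∣⁅x⁆∣≡1; ⊥⊆; ∣⊥∣≡0; out⊆; s⊆s; drop-∷-⊆; p─⊥≡p; p─q⊆p; x∈p∧x≢y⇒x∈p-y;
         x∈p∪q⁺; x∈p∪q⁻; x∈p∩q⁻; x∈∁p⇒x∉p; p⊆q⇒∣p∣≤∣q∣; p∩q⊆p; _∈?_)
open import Data.Bool using (Bool; true; false; _∧_; _∨_; not; T; T?)
open import Data.Bool.Properties using (T-≡; T-∧; ∨-identityʳ; ¬-not) renaming (_≟_ to _≟ᵇ_)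
open import Data.Vec using ([]; _∷_; lookup; tabulate; here; there)
open import Data.Vec.Properties using (lookup∘tabulate; lookup⇒[]=; []=⇒lookup)
open import Data.Product using (Σ; _×_; _,_; proj₁; proj₂; ∃)
open import Data.Sum using (inj₁; inj₂)
open import Data.Empty using (⊥-elim)
open import Function using (_∘_; id)
open import Data.List using (length; filterᵇ)
import Data.List as List
import Data.List.Membership.Propositional as Listₘ
open import Data.List.Membership.Propositional using (lose)
open import Data.List.Membership.Propositional.Properties using (∈-filter⁺; ∈-map⁺; ∈-++⁺ˡ; ∈-++⁺ʳ)
open import Data.List.Relation.Unary.Any using (here)
import Data.List.Relation.Unary.All.Properties as All
open import Data.List.Relation.Unary.All.Properties using (all⁺; all⁻)
open import Data.List.Relation.Unary.Any.Properties using (any⁺)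
open import Function.Definitions using (Injective)
open import Relation.Nullary using (¬_; yes; no)
open import Relation.Nullary.Decidable using (dec-false; _×-dec_)
open import Function.Bundles using (Equivalence)
open import Relation.Binary.PropositionalEquality

Disjoint : ∀ {n} → Subset n → Subset n → Set
Disjoint p q = ∀ {x} → x ∈ p → x ∉ q

Disjoint-∷ : ∀ {n s t} {p q : Subset n} → Disjoint (s ∷ p) (t ∷ q) → Disjoint p q
Disjoint-∷ disj x∈p x∈q = disj (there x∈p) (there x∈q)

∣p∪q∣≡∣p∣+∣q∣ : ∀ {n} {p q : Subset n} → Disjoint p q → ∣ p ∪ q ∣ ≡ ∣ p ∣ + ∣ q ∣
∣p∪q∣≡∣p∣+∣q∣ {p = []}        {[]}         _    = refl
∣p∪q∣≡∣p∣+∣q∣ {p = true  ∷ p} {true  ∷ q} disj = ⊥-elim (disj here here)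
∣p∪q∣≡∣p∣+∣q∣ {p = true  ∷ p} {false ∷ q} disj = cong suc (∣p∪q∣≡∣p∣+∣q∣ (Disjoint-∷ disj))
∣p∪q∣≡∣p∣+∣q∣ {p = false ∷ p} {true  ∷ q} disj =
  trans (cong suc (∣p∪q∣≡∣p∣+∣q∣ (Disjoint-∷ disj))) (sym (+-suc ∣ p ∣ ∣ q ∣))
∣p∪q∣≡∣p∣+∣q∣ {p = false ∷ p} {false ∷ q} disj = ∣p∪q∣≡∣p∣+∣q∣ (Disjoint-∷ disj)

∣⁅x⁆∪p∣≡1+∣p∣ : ∀ {n} {x : Fin n} {p : Subset n} → x ∉ p → ∣ ⁅ x ⁆ ∪ p ∣ ≡ suc ∣ p ∣
∣⁅x⁆∪p∣≡1+∣p∣ {x = x} {p} x∉p =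
  trans (∣p∪q∣≡∣p∣+∣q∣ (λ y∈⁅x⁆ y∈p → x∉p (subst (_∈ p) (x∈⁅y⁆⇒x≡y x y∈⁅x⁆) y∈p)))
        (cong (_+ ∣ p ∣) (∣⁅x⁆∣≡1 x))

∣p∣≡∣p∩q∣+∣p∩∁q∣ : ∀ {n} (p q : Subset n) → ∣ p ∣ ≡ ∣ p ∩ q ∣ + ∣ p ∩ ∁ q ∣
∣p∣≡∣p∩q∣+∣p∩∁q∣ []          []          = refl
∣p∣≡∣p∩q∣+∣p∩∁q∣ (true  ∷ p) (true  ∷ q) = cong suc (∣p∣≡∣p∩q∣+∣p∩∁q∣ p q)
∣p∣≡∣p∩q∣+∣p∩∁q∣ (true  ∷ p) (false ∷ q) =
  trans (cong suc (∣p∣≡∣p∩q∣+∣p∩∁q∣ p q)) (sym (+-suc ∣ p ∩ q ∣ ∣ p ∩ ∁ q ∣))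
∣p∣≡∣p∩q∣+∣p∩∁q∣ (false ∷ p) (_     ∷ q) = ∣p∣≡∣p∩q∣+∣p∩∁q∣ p q

x∈p⇒∣p∣≡1+∣p-x∣ : ∀ {n} {x : Fin n} {p : Subset n} → x ∈ p → ∣ p ∣ ≡ suc ∣ p - x ∣
x∈p⇒∣p∣≡1+∣p-x∣ {p = true ∷ p}  here         = cong (suc ∘ ∣_∣) (sym (p─⊥≡p p))
x∈p⇒∣p∣≡1+∣p-x∣ {p = true ∷ p}  (there x∈p) = cong suc (x∈p⇒∣p∣≡1+∣p-x∣ x∈p)
x∈p⇒∣p∣≡1+∣p-x∣ {p = false ∷ p} (there x∈p) = x∈p⇒∣p∣≡1+∣p-x∣ x∈p

x∈p-y⇒x≢y : ∀ {n} {x y : Fin n} {p : Subset n} → x ∈ p - y → x ≢ y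
x∈p-y⇒x≢y {x = zero}  {suc y} {true ∷ p} here        ()
x∈p-y⇒x≢y {x = suc x} {zero}  {s ∷ p}    (there _)   ()
x∈p-y⇒x≢y {x = suc x} {suc y} {s ∷ p}    (there x∈p) refl = x∈p-y⇒x≢y x∈p refl

⊆-with-size : ∀ {n} {p q : Subset n} k → p ⊆ q → ∣ p ∣ ≤ k → k ≤ ∣ q ∣ →
  ∃ λ t → p ⊆ t × t ⊆ q × ∣ t ∣ ≡ k
⊆-with-size {p = []} {[]} zero _ _ _ = [] , (λ ()) , (λ ()) , refl
⊆-with-size {p = true ∷ p} {false ∷ q} k p⊆q _ _ with () ← p⊆q here
⊆-with-size {p = true ∷ p} {true ∷ q} (suc k) p⊆q (s≤s p≤k) (s≤s k≤q)
  with t , p⊆t , t⊆q , ∣t∣≡k ← ⊆-with-size k (drop-∷-⊆ p⊆q) p≤k k≤q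
  = true ∷ t , s⊆s p⊆t , s⊆s t⊆q , cong suc ∣t∣≡k
⊆-with-size {p = false ∷ p} {false ∷ q} k p⊆q p≤k k≤q
  with t , p⊆t , t⊆q , ∣t∣≡k ← ⊆-with-size k (drop-∷-⊆ p⊆q) p≤k k≤q
  = false ∷ t , s⊆s p⊆t , s⊆s t⊆q , ∣t∣≡k
⊆-with-size {p = false ∷ p} {true ∷ q} k p⊆q p≤k k≤1+q with k ≤? ∣ q ∣
... | yes k≤q with t , p⊆t , t⊆q , ∣t∣≡k ← ⊆-with-size k (drop-∷-⊆ p⊆q) p≤k k≤q
  = false ∷ t , s⊆s p⊆t , out⊆ t⊆q , ∣t∣≡k
⊆-with-size {p = false ∷ p} {true ∷ q} (suc k) p⊆q _ (s≤s k≤q) | no 1+k≰q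
  with t , p⊆t , t⊆q , ∣t∣≡k ←
       ⊆-with-size k (drop-∷-⊆ p⊆q) (≤-trans (p⊆q⇒∣p∣≤∣q∣ (drop-∷-⊆ p⊆q)) (≤-pred (≰⇒> 1+k≰q))) k≤q
  = true ∷ t , out⊆ p⊆t , s⊆s t⊆q , cong suc ∣t∣≡k
⊆-with-size {p = false ∷ p} {true ∷ q} zero _ _ _ | no 0≰q = ⊥-elim (0≰q z≤n)

Lift-⁅⁆∪ : ∀ {n ℓ} {P : Fin n → Set ℓ} {x : Fin n} {p : Subset n} → P x → Lift P p → Lift P (⁅ x ⁆ ∪ p)
Lift-⁅⁆∪ {x = x} {p} Px Pp y∈ with x∈p∪q⁻ ⁅ x ⁆ p y∈
... | inj₁ y∈⁅x⁆ rewrite x∈⁅y⁆⇒x≡y x y∈⁅x⁆ = Px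
... | inj₂ y∈p = Pp y∈p

∈-tabulate⁺ : ∀ {n} {f : Fin n → Bool} {x} → f x ≡ true → x ∈ tabulate f
∈-tabulate⁺ {f = f} {x} fx = lookup⇒[]= x (tabulate f) (trans (lookup∘tabulate f x) fx)

∈-tabulate⁻ : ∀ {n} {f : Fin n → Bool} {x} → x ∈ tabulate f → f x ≡ true
∈-tabulate⁻ {f = f} {x} x∈ = trans (sym (lookup∘tabulate f x)) ([]=⇒lookup x∈)

length-filterᵇ-tabulate : ∀ {A : Set} {n} (p : A → Bool) (f : Fin n → A) →
  length (filterᵇ p (List.tabulate f)) ≡ ∣ tabulate (p ∘ f) ∣
length-filterᵇ-tabulate {n = zero}  p f = refl
length-filterᵇ-tabulate {n = suc n} p f with p (f zero)
... | true  = cong suc (length-filterᵇ-tabulate p (f ∘ suc))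
... | false = length-filterᵇ-tabulate p (f ∘ suc)

image : ∀ {k n} → (Fin k → Fin n) → Subset n
image {zero}  a = ⊥
image {suc k} a = ⁅ a zero ⁆ ∪ image (a ∘ suc)

∈-image⁺ : ∀ {k n} (a : Fin k → Fin n) j → a j ∈ image a
∈-image⁺ a zero    = x∈p∪q⁺ (inj₁ (x∈⁅x⁆ (a zero)))
∈-image⁺ a (suc j) = x∈p∪q⁺ (inj₂ (∈-image⁺ (a ∘ suc) j))

∈-image⁻ : ∀ {k n} (a : Fin k → Fin n) {x} → x ∈ image a → ∃ λ j → a j ≡ x
∈-image⁻ {zero}  a x∈ = ⊥-elim (∉⊥ x∈)
∈-image⁻ {suc k} a x∈ with x∈p∪q⁻ ⁅ a zero ⁆ (image (a ∘ suc)) x∈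
... | inj₁ x∈⁅a₀⁆ = zero , sym (x∈⁅y⁆⇒x≡y (a zero) x∈⁅a₀⁆)
... | inj₂ x∈img with j , aj≡x ← ∈-image⁻ (a ∘ suc) x∈img = suc j , aj≡x

∣image∣≡k : ∀ {k n} (a : Fin k → Fin n) → Injective _≡_ _≡_ a → ∣ image a ∣ ≡ k
∣image∣≡k {zero}  {n} a _   = ∣⊥∣≡0 n
∣image∣≡k {suc k}     a inj =
  trans (∣⁅x⁆∪p∣≡1+∣p∣ a₀∉img) (cong suc (∣image∣≡k (a ∘ suc) (Fin.suc-injective ∘ inj)))
  where
  a₀∉img : a zero ∉ image (a ∘ suc)
  a₀∉img a₀∈ with j , aj≡a₀ ← ∈-image⁻ (a ∘ suc) a₀∈ with () ← inj aj≡a₀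

allSubsets-complete : ∀ {n} (S : Subset n) → S Listₘ.∈ allSubsets n
allSubsets-complete {zero}  []          = here refl
allSubsets-complete {suc n} (false ∷ S) = ∈-++⁺ˡ (∈-map⁺ (false ∷_) (allSubsets-complete S))
allSubsets-complete {suc n} (true  ∷ S) =
  ∈-++⁺ʳ (List.map (false ∷_) (allSubsets n)) (∈-map⁺ (true ∷_) (allSubsets-complete S))

IsClique : ∀ {n} → Adj n → Subset n → Set
IsClique a S = ∀ {i j} → i ∈ S → j ∈ S → i ≢ j → a i j ≡ true

IsClique-⊆ : ∀ {n} {a : Adj n} {S T : Subset n} → S ⊆ T → IsClique a T → IsClique a S
IsClique-⊆ S⊆T cl i∈S j∈S = cl (S⊆T i∈S) (S⊆T j∈S)

IsClique⇒isCliqueᵇ : ∀ {n} {a : Adj n} {S : Subset n} → IsClique a S → isCliqueᵇ a S ≡ true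
IsClique⇒isCliqueᵇ {a = a} {S} cl =
  Equivalence.to T-≡ (all⁻ _ (All.tabulate⁺ λ i → all⁻ _ (All.tabulate⁺ λ j → Equivalence.from T-≡ (clause i j))))
  where
  clause : ∀ i j → (not (lookup S i ∧ lookup S j ∧ not (i == j)) ∨ a i j) ≡ true
  clause i j with lookup S i in Si | lookup S j in Sj | i ≟ j
  ... | false | _     | _       = refl
  ... | true  | false | _       = refl
  ... | true  | true  | yes _   = refl
  ... | true  | true  | no i≢j = cl (lookup⇒[]= i S Si) (lookup⇒[]= j S Sj) i≢j

isCliqueᵇ⇒IsClique : ∀ {n} {a : Adj n} {S : Subset n} → isCliqueᵇ a S ≡ true → IsClique a S
isCliqueᵇ⇒IsClique {a = a} {S} cl {i} {j} i∈S j∈S i≢j =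
  clause (Equivalence.to T-≡ (All.tabulate⁻ (all⁺ _ _ (All.tabulate⁻ (all⁺ _ _ (Equivalence.from T-≡ cl)) i)) j))
  where
  clause : (not (lookup S i ∧ lookup S j ∧ not (i == j)) ∨ a i j) ≡ true → a i j ≡ true
  clause h rewrite []=⇒lookup i∈S | []=⇒lookup j∈S | dec-false (i ≟ j) i≢j = h

IsClique⇒isKᵇ : ∀ {n} {a : Adj n} {S : Subset n} {k} → IsClique a S → ∣ S ∣ ≡ k → isKᵇ a k S ≡ true
IsClique⇒isKᵇ {S = S} cl refl rewrite IsClique⇒isCliqueᵇ cl = Equivalence.to T-≡ (≡⇒≡ᵇ ∣ S ∣ ∣ S ∣ refl)

isKᵇ⇒IsClique : ∀ {n} {a : Adj n} {S : Subset n} {k} → isKᵇ a k S ≡ true → IsClique a S × ∣ S ∣ ≡ k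
isKᵇ⇒IsClique {a = a} {S} {k} K with Equivalence.to (T-∧ {isCliqueᵇ a S}) (Equivalence.from T-≡ K)
... | cl , size = isCliqueᵇ⇒IsClique (Equivalence.to T-≡ cl) , ≡ᵇ⇒≡ ∣ S ∣ k size

IsClique⇒HasK : ∀ {n} {a : Adj n} {S : Subset n} {k} → IsClique a S → k ≤ ∣ S ∣ → HasK a k
IsClique⇒HasK {n = n} {k = k} cl k≤S
  with t , _ , t⊆S , ∣t∣≡k ← ⊆-with-size k ⊥⊆ (≤-trans (≤-reflexive (∣⊥∣≡0 n)) z≤n) k≤S
  = t , IsClique⇒isKᵇ (IsClique-⊆ t⊆S cl) ∣t∣≡k

∣⁅x⁆∪⁅y⁆∣≡2 : ∀ {n} {x y : Fin n} → x ≢ y → ∣ ⁅ x ⁆ ∪ ⁅ y ⁆ ∣ ≡ 2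
∣⁅x⁆∪⁅y⁆∣≡2 {y = y} x≢y = trans (∣⁅x⁆∪p∣≡1+∣p∣ (x≢y ∘ x∈⁅y⁆⇒x≡y y)) (cong suc (∣⁅x⁆∣≡1 y))

⁅x⁆∪⁅y⁆⊆p : ∀ {n} {x y : Fin n} {p : Subset n} → x ∈ p → y ∈ p → ⁅ x ⁆ ∪ ⁅ y ⁆ ⊆ p
⁅x⁆∪⁅y⁆⊆p {y = y} {p} x∈p y∈p = Lift-⁅⁆∪ x∈p (λ z∈⁅y⁆ → subst (_∈ p) (sym (x∈⁅y⁆⇒x≡y y z∈⁅y⁆)) y∈p)

copy⇒inE1 : ∀ {n} (G : SimpleGraph n) {r t u v} → isKᵇ (adj G) r t ≡ true →
  u ∈ t → v ∈ t → adj G u v ≡ true → inE1ᵇ G r u v ≡ true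
copy⇒inE1 G {r} {t} {u} {v} K u∈t v∈t u∼v rewrite u∼v =
  Equivalence.to T-≡ (any⁺ _ (lose t∈copies (Equivalence.from T-∧ (∈⇒T u∈t , ∈⇒T v∈t))))
  where
  ∈⇒T : ∀ {x} → x ∈ t → T (lookup t x)
  ∈⇒T x∈t = Equivalence.from T-≡ ([]=⇒lookup x∈t)
  t∈copies : t Listₘ.∈ copiesList (adj G) r
  t∈copies = ∈-filter⁺ (T? ∘ isKᵇ (adj G) r) (allSubsets-complete t) (Equivalence.from T-≡ K)

IsClique⇒inE1 : ∀ {n} (G : SimpleGraph n) {r S} → 2 ≤ r → IsClique (adj G) S → r ≤ ∣ S ∣ →
  ∀ {u v} → u ∈ S → v ∈ S → u ≢ v → inE1ᵇ G r u v ≡ true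
IsClique⇒inE1 G {r} 2≤r cl r≤S {u} {v} u∈S v∈S u≢v
  with t , uv⊆t , t⊆S , ∣t∣≡r ← ⊆-with-size r (⁅x⁆∪⁅y⁆⊆p u∈S v∈S) (≤-trans (≤-reflexive (∣⁅x⁆∪⁅y⁆∣≡2 u≢v)) 2≤r) r≤S
  = copy⇒inE1 G (IsClique⇒isKᵇ (IsClique-⊆ t⊆S cl) ∣t∣≡r)
      (uv⊆t (x∈p∪q⁺ (inj₁ (x∈⁅x⁆ u)))) (uv⊆t (x∈p∪q⁺ (inj₂ (x∈⁅x⁆ v)))) (cl u∈S v∈S u≢v)

AdjacentToAll : ∀ {n} → SimpleGraph n → Fin n → Subset n → Set
AdjacentToAll G x = Lift (λ i → adj G x i ≡ true)

module _ {n} (G : SimpleGraph n) where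

  adj⇒≢ : ∀ {x y} → adj G x y ≡ true → x ≢ y
  adj⇒≢ {x} x∼x refl with () ← trans (sym x∼x) (irrefl G x)

  adjacent⇒∉ : ∀ {x S} → AdjacentToAll G x S → x ∉ S
  adjacent⇒∉ x∼S x∈S = adj⇒≢ (x∼S x∈S) refl

  adjacent⇒∣⁅x⁆∪p∣≡1+∣p∣ : ∀ {x S} → AdjacentToAll G x S → ∣ ⁅ x ⁆ ∪ S ∣ ≡ suc ∣ S ∣
  adjacent⇒∣⁅x⁆∪p∣≡1+∣p∣ = ∣⁅x⁆∪p∣≡1+∣p∣ ∘ adjacent⇒∉

  IsClique-∪ : ∀ {S T} → IsClique (adj G) S → IsClique (adj G) T →
    (∀ {i j} → i ∈ S → j ∈ T → adj G i j ≡ true) → IsClique (adj G) (S ∪ T)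
  IsClique-∪ {S} {T} clS clT S∼T i∈ j∈ i≢j with x∈p∪q⁻ S T i∈ | x∈p∪q⁻ S T j∈
  ... | inj₁ i∈S | inj₁ j∈S = clS i∈S j∈S i≢j
  ... | inj₂ i∈T | inj₂ j∈T = clT i∈T j∈T i≢j
  ... | inj₁ i∈S | inj₂ j∈T = S∼T i∈S j∈T
  ... | inj₂ i∈T | inj₁ j∈S = trans (SimpleGraph.sym G _ _) (S∼T j∈S i∈T)

  IsClique-insert : ∀ {x S} → IsClique (adj G) S → AdjacentToAll G x S →
    IsClique (adj G) (⁅ x ⁆ ∪ S)
  IsClique-insert {x} cl x∼S = IsClique-∪ ⁅x⁆-clique cl x∼
    where
    ⁅x⁆-clique : IsClique (adj G) ⁅ x ⁆
    ⁅x⁆-clique i∈ j∈ i≢j = ⊥-elim (i≢j (trans (x∈⁅y⁆⇒x≡y x i∈) (sym (x∈⁅y⁆⇒x≡y x j∈))))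
    x∼ : ∀ {i j} → i ∈ ⁅ x ⁆ → j ∈ _ → adj G i j ≡ true
    x∼ i∈ j∈S rewrite x∈⁅y⁆⇒x≡y x i∈ = x∼S j∈S

==∧==≡false : ∀ {n} {x x′ y y′ : Fin n} → ¬ (x ≡ x′ × y ≡ y′) → ((x == x′) ∧ (y == y′)) ≡ false
==∧==≡false {x = x} {x′} {y} {y′} ¬eq with x ≟ x′ | y ≟ y′
... | yes x≡x′ | yes y≡y′ = ⊥-elim (¬eq (x≡x′ , y≡y′))
... | yes _    | no _     = refl
... | no _     | _        = refl

addEdge-≡ : ∀ {n} (a : Adj n) {u w i j} → ¬ (i ≡ u × j ≡ w) → ¬ (i ≡ w × j ≡ u) →
  addEdge a u w i j ≡ a i j
addEdge-≡ a {i = i} {j} ¬uw ¬wu rewrite ==∧==≡false ¬uw | ==∧==≡false ¬wu = ∨-identityʳ (a i j)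

addEdge-IsClique⁻ : ∀ {n} (a : Adj n) {u w S} → IsClique (addEdge a u w) S → ¬ (u ∈ S × w ∈ S) →
  IsClique a S
addEdge-IsClique⁻ a {S = S} cl ¬uw∈S i∈S j∈S i≢j =
  trans (sym (addEdge-≡ a (λ (i≡u , j≡w) → ¬uw∈S (subst (_∈ S) i≡u i∈S , subst (_∈ S) j≡w j∈S))
                          (λ (i≡w , j≡u) → ¬uw∈S (subst (_∈ S) j≡u j∈S , subst (_∈ S) i≡w i∈S))))
        (cl i∈S j∈S i≢j)

-- The part of a K_{k+2} of G + xy outside {x, y}, as provided by saturation.
record CommonNeighbourClique {n} (G : SimpleGraph n) (k : ℕ) (x y : Fin n) : Set where
  field
    members  : Subset n
    isClique : IsClique (adj G) members
    size     : ∣ members ∣ ≡ k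
    x∼       : AdjacentToAll G x members
    y∼       : AdjacentToAll G y members

saturated⇒CommonNeighbourClique : ∀ {n} {G : SimpleGraph n} {k} → Saturated G (suc (suc k)) →
  ∀ {u w} → u ≢ w → adj G u w ≡ false → CommonNeighbourClique G k u w
saturated⇒CommonNeighbourClique {G = G} {k} (Kₛ-free , saturated) {u} {w} u≢w u≁w
  with S , K ← saturated u w u≢w u≁w
  with clS , ∣S∣≡2+k ← isKᵇ⇒IsClique K
  with u ∈? S ×-dec w ∈? S
... | no ¬uw∈S = ⊥-elim (Kₛ-free (IsClique⇒HasK (addEdge-IsClique⁻ (adj G) clS ¬uw∈S) (≤-reflexive (sym ∣S∣≡2+k))))
... | yes (u∈S , w∈S) = record
  { members  = S - u - w
  ; isClique = IsClique-⊆ (p─q⊆p (S - u) ⁅ w ⁆) clS-u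
  ; size     = suc-injective (suc-injective (trans
                 (sym (trans (x∈p⇒∣p∣≡1+∣p-x∣ u∈S) (cong suc (x∈p⇒∣p∣≡1+∣p-x∣ w∈S-u)))) ∣S∣≡2+k))
  ; x∼       = λ i∈Q → clS-w u∈S-w (in-S-w i∈Q) (λ u≡i → x∈p-y⇒x≢y (in-S-u i∈Q) (sym u≡i))
  ; y∼       = λ i∈Q → clS-u w∈S-u (in-S-u i∈Q) (λ w≡i → x∈p-y⇒x≢y i∈Q (sym w≡i))
  }
  where
  clS-u : IsClique (adj G) (S - u)
  clS-u = addEdge-IsClique⁻ (adj G) (IsClique-⊆ (p─q⊆p S ⁅ u ⁆) clS) (λ (u∈ , _) → x∈p-y⇒x≢y u∈ refl)
  clS-w : IsClique (adj G) (S - w)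
  clS-w = addEdge-IsClique⁻ (adj G) (IsClique-⊆ (p─q⊆p S ⁅ w ⁆) clS) (λ (_ , w∈) → x∈p-y⇒x≢y w∈ refl)
  u∈S-w : u ∈ S - w
  u∈S-w = x∈p∧x≢y⇒x∈p-y u∈S u≢w
  w∈S-u : w ∈ S - u
  w∈S-u = x∈p∧x≢y⇒x∈p-y w∈S (u≢w ∘ sym)
  in-S-u : ∀ {i} → i ∈ S - u - w → i ∈ S - u
  in-S-u = p─q⊆p (S - u) ⁅ w ⁆
  in-S-w : ∀ {i} → i ∈ S - u - w → i ∈ S - w
  in-S-w i∈Q = x∈p∧x≢y⇒x∈p-y (p─q⊆p S ⁅ u ⁆ (in-S-u i∈Q)) (x∈p-y⇒x≢y i∈Q)

∣p∣≤deg1 : ∀ {n} (G : SimpleGraph n) {r v} {p : Subset n} →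
  Lift (λ u → inE1ᵇ G r u v ≡ true) p → ∣ p ∣ ≤ deg1 G r v
∣p∣≤deg1 G {r} {v} E1 =
  ≤-trans (p⊆q⇒∣p∣≤∣q∣ (∈-tabulate⁺ ∘ E1)) (≤-reflexive (sym (length-filterᵇ-tabulate (λ u → inE1ᵇ G r u v) id)))

CommonNeighbourClique⇒inE1 : ∀ {n} {G : SimpleGraph n} {r k x y} → 2 ≤ r → r ≤ suc k →
  (Q : CommonNeighbourClique G k x y) → Lift (λ i → inE1ᵇ G r i x ≡ true) (CommonNeighbourClique.members Q)
CommonNeighbourClique⇒inE1 {G = G} {x = x} 2≤r r≤1+k Q i∈Q =
  IsClique⇒inE1 G 2≤r (IsClique-insert G isClique x∼)
    (≤-trans r≤1+k (≤-reflexive (sym (trans (adjacent⇒∣⁅x⁆∪p∣≡1+∣p∣ G x∼) (cong suc size)))))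
    (x∈p∪q⁺ (inj₂ i∈Q)) (x∈p∪q⁺ (inj₁ (x∈⁅x⁆ x))) (adj⇒≢ G (x∼ i∈Q) ∘ sym)
  where open CommonNeighbourClique Q

edge+common-neighbour-clique⇒inE1 : ∀ {n} (G : SimpleGraph n) {r u v P} → 2 ≤ r → adj G v u ≡ true →
  IsClique (adj G) P → AdjacentToAll G v P → AdjacentToAll G u P →
  r ≤ 2 + ∣ P ∣ → inE1ᵇ G r v u ≡ true
edge+common-neighbour-clique⇒inE1 G {u = u} {v} 2≤r v∼u clP v∼P u∼P r≤2+P =
  IsClique⇒inE1 G 2≤r (IsClique-insert G (IsClique-insert G clP u∼P) v∼uP)
    (≤-trans r≤2+P (≤-reflexive (sym (trans (adjacent⇒∣⁅x⁆∪p∣≡1+∣p∣ G v∼uP)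
                                            (cong suc (adjacent⇒∣⁅x⁆∪p∣≡1+∣p∣ G u∼P))))))
    (x∈p∪q⁺ (inj₁ (x∈⁅x⁆ v))) (x∈p∪q⁺ (inj₂ (x∈p∪q⁺ (inj₁ (x∈⁅x⁆ u))))) (adj⇒≢ G v∼u)
  where
  v∼uP : AdjacentToAll G v (⁅ u ⁆ ∪ _)
  v∼uP = Lift-⁅⁆∪ v∼u v∼P

≤1+c+d∧≰2+c⇒2≤d : ∀ {r c d} → r ≤ suc (c + d) → ¬ r ≤ 2 + c → 2 ≤ d
≤1+c+d∧≰2+c⇒2≤d {c = c} {d} r≤1+c+d r≰2+c =
  +-cancelˡ-≤ c 2 d (≤-trans (≤-reflexive (+-comm c 2)) (≤-pred (≤-trans (≰⇒> r≰2+c) r≤1+c+d)))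

-- v is a vertex of B ∖ C and a enumerates the vertices a₁, …, a_{s-2} witnessing v ∈ B.
module LowE1Degree {n k r} (G : SimpleGraph n) (2≤r : 2 ≤ r) (r≤1+k : r ≤ suc k)
  (saturated : Saturated G (suc (suc k))) {v : Fin n} {a : Fin k → Fin n}
  (v∼a : ∀ i → adj G v (a i) ≡ true)
  (a∼a : ∀ i j → i ≢ j → adj G (a i) (a j) ≡ true)
  (deg1≤k : deg1 G r v ≤ k) where

  Kₛ-free : ¬ HasK (adj G) (suc (suc k))
  Kₛ-free = proj₁ saturated

  A : Subset n
  A = image a

  a-injective : Injective _≡_ _≡_ a
  a-injective {i} {j} ai≡aj with i ≟ j
  ... | yes i≡j = i≡j
  ... | no i≢j  = ⊥-elim (adj⇒≢ G (a∼a i j i≢j) ai≡aj)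

  A-clique : IsClique (adj G) A
  A-clique i∈A j∈A i≢j with p , refl ← ∈-image⁻ a i∈A | q , refl ← ∈-image⁻ a j∈A =
    a∼a p q (i≢j ∘ cong a)

  v∼A : AdjacentToAll G v A
  v∼A i∈A with j , refl ← ∈-image⁻ a i∈A = v∼a j

  ∣vA∣≡1+k : ∣ ⁅ v ⁆ ∪ A ∣ ≡ suc k
  ∣vA∣≡1+k = trans (adjacent⇒∣⁅x⁆∪p∣≡1+∣p∣ G v∼A) (cong suc (∣image∣≡k a a-injective))

  vA-inE1 : ∀ {i j} → i ∈ ⁅ v ⁆ ∪ A → j ∈ ⁅ v ⁆ ∪ A → i ≢ j → inE1ᵇ G r i j ≡ true
  vA-inE1 = IsClique⇒inE1 G 2≤r (IsClique-insert G A-clique v∼A) (≤-trans r≤1+k (≤-reflexive (sym ∣vA∣≡1+k)))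

  non-neighbour∼A : ∀ {w} → w ≢ v → adj G v w ≡ false → AdjacentToAll G w A
  non-neighbour∼A {w} w≢v v≁w {i} i∈A with adj G w i in w∼i
  ... | true  = refl
  ... | false = ⊥-elim (1+n≰n (≤-trans (≤-reflexive (sym ∣iQ∣≡1+k)) (≤-trans (∣p∣≤deg1 G iQ-inE1) deg1≤k)))
    where
    Q : CommonNeighbourClique G k v w
    Q = saturated⇒CommonNeighbourClique {G = G} saturated (w≢v ∘ sym) v≁w
    open CommonNeighbourClique Q
    i∉Q : i ∉ members
    i∉Q i∈Q with () ← trans (sym w∼i) (y∼ i∈Q)
    ∣iQ∣≡1+k : ∣ ⁅ i ⁆ ∪ members ∣ ≡ suc k
    ∣iQ∣≡1+k = trans (∣⁅x⁆∪p∣≡1+∣p∣ i∉Q) (cong suc size)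
    iQ-inE1 : Lift (λ x → inE1ᵇ G r x v ≡ true) (⁅ i ⁆ ∪ members)
    iQ-inE1 = Lift-⁅⁆∪ (vA-inE1 (x∈p∪q⁺ (inj₂ i∈A)) (x∈p∪q⁺ (inj₁ (x∈⁅x⁆ v))) (adj⇒≢ G (v∼A i∈A) ∘ sym))
                       (CommonNeighbourClique⇒inE1 2≤r r≤1+k Q)

  adjacent-to-vA⇒Kₛ : ∀ {u} → adj G v u ≡ true → (∀ j → adj G u (a j) ≡ true) → HasK (adj G) (suc (suc k))
  adjacent-to-vA⇒Kₛ {u} v∼u u∼a =
    IsClique⇒HasK (IsClique-insert G (IsClique-insert G A-clique v∼A) u∼vA)
      (≤-reflexive (sym (trans (adjacent⇒∣⁅x⁆∪p∣≡1+∣p∣ G u∼vA) (cong suc ∣vA∣≡1+k))))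
    where
    u∼A : AdjacentToAll G u A
    u∼A i∈A with j , refl ← ∈-image⁻ a i∈A = u∼a j
    u∼vA : AdjacentToAll G u (⁅ v ⁆ ∪ A)
    u∼vA = Lift-⁅⁆∪ (trans (SimpleGraph.sym G u v) v∼u) u∼A

  module _ {u x : Fin n} (v∼u : adj G v u ≡ true) (Q : CommonNeighbourClique G k u x) where
    open CommonNeighbourClique Q

    N : Subset n
    N = tabulate (adj G v)

    R : Subset n
    R = members ∩ ∁ N

    ∣Q∩N∣+∣R∣≡k : ∣ members ∩ N ∣ + ∣ R ∣ ≡ k
    ∣Q∩N∣+∣R∣≡k = trans (sym (∣p∣≡∣p∩q∣+∣p∩∁q∣ members N)) size

    large-R⇒Kₛ : v ∉ members → 2 ≤ ∣ R ∣ → HasK (adj G) (suc (suc k))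
    large-R⇒Kₛ v∉Q 2≤R =
      IsClique⇒HasK (IsClique-∪ G A-clique (IsClique-⊆ (p∩q⊆p members (∁ N)) isClique) A∼R)
        (≤-trans (≤-reflexive (+-comm 2 k)) (≤-trans (+-monoʳ-≤ k 2≤R) (≤-reflexive (sym ∣A∪R∣≡k+∣R∣))))
      where
      R-non-neighbour : ∀ {i} → i ∈ R → i ≢ v × adj G v i ≡ false
      R-non-neighbour i∈R with i∈Q , i∈∁N ← x∈p∩q⁻ members (∁ N) i∈R =
        (λ i≡v → v∉Q (subst (_∈ members) i≡v i∈Q)) , ¬-not (x∈∁p⇒x∉p i∈∁N ∘ ∈-tabulate⁺)
      A∼R : ∀ {i j} → i ∈ A → j ∈ R → adj G i j ≡ true
      A∼R i∈A j∈R with j≢v , v≁j ← R-non-neighbour j∈R =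
        trans (SimpleGraph.sym G _ _) (non-neighbour∼A j≢v v≁j i∈A)
      ∣A∪R∣≡k+∣R∣ : ∣ A ∪ R ∣ ≡ k + ∣ R ∣
      ∣A∪R∣≡k+∣R∣ = trans (∣p∪q∣≡∣p∣+∣q∣ (λ i∈A i∈R → x∈∁p⇒x∉p (proj₂ (x∈p∩q⁻ members (∁ N) i∈R)) (∈-tabulate⁺ (v∼A i∈A))))
                          (cong (_+ ∣ R ∣) (∣image∣≡k a a-injective))

    CommonNeighbourClique⇒vu-inE1 : inE1ᵇ G r v u ≡ true
    CommonNeighbourClique⇒vu-inE1 with v ∈? members
    ... | yes v∈Q = CommonNeighbourClique⇒inE1 2≤r r≤1+k Q v∈Q
    ... | no v∉Q with r ≤? 2 + ∣ members ∩ N ∣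
    ...   | yes r≤2+∣Q∩N∣ =
      edge+common-neighbour-clique⇒inE1 G 2≤r v∼u (IsClique-⊆ (p∩q⊆p members N) isClique)
        (∈-tabulate⁻ ∘ proj₂ ∘ x∈p∩q⁻ members N) (x∼ ∘ p∩q⊆p members N) r≤2+∣Q∩N∣
    ...   | no r≰2+∣Q∩N∣ =
      ⊥-elim (Kₛ-free (large-R⇒Kₛ v∉Q (≤1+c+d∧≰2+c⇒2≤d (≤-trans r≤1+k (≤-reflexive (cong suc (sym ∣Q∩N∣+∣R∣≡k)))) r≰2+∣Q∩N∣)))

  vu-inE1 : ∀ {u} → adj G v u ≡ true → inE1ᵇ G r v u ≡ true
  vu-inE1 {u} v∼u with all? (λ j → adj G u (a j) ≟ᵇ true)
  ... | yes u∼a = ⊥-elim (Kₛ-free (adjacent-to-vA⇒Kₛ v∼u u∼a))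
  ... | no ¬u∼a with j , u≁aj ← ¬∀⟶∃¬ k _ (λ j → adj G u (a j) ≟ᵇ true) ¬u∼a with u ≟ a j
  ...   | yes refl = vA-inE1 (x∈p∪q⁺ (inj₁ (x∈⁅x⁆ v))) (x∈p∪q⁺ (inj₂ (∈-image⁺ a j))) (adj⇒≢ G v∼u)
  ...   | no u≢aj  =
    CommonNeighbourClique⇒vu-inE1 v∼u (saturated⇒CommonNeighbourClique {G = G} saturated u≢aj (¬-not u≁aj))

lemma3p2 : (r s n : ℕ) → 2 ≤ r → r < s →
    (G : SimpleGraph n) → Saturated G s →
    (m : ℕ) → IsSat n r s m →
    (4 * r * r) * copies (adj G) r ≤ (4 * r * r) * m + n →
    (v : Fin n) →
    deg1 G r v ^ 3 ≤ n →
    (Σ (Fin (s ∸ 2) → Fin n) λ a →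
        (∀ i → ¬ (deg1 G r (a i) ^ 3 ≤ n)) ×
        (∀ i → adj G v (a i) ≡ true) ×
        (∀ i j → i ≢ j → adj G (a i) (a j) ≡ true)) →
    deg1 G r v ≤ s ∸ 2 →
    ∀ (u : Fin n) → adj G v u ≡ true → inE1ᵇ G r v u ≡ true
lemma3p2 r (suc (suc k)) _ 2≤r (s≤s r≤1+k) G saturated _ _ _ v _ (a , _ , v∼a , a∼a) deg1≤k u =
  LowE1Degree.vu-inE1 G 2≤r r≤1+k saturated v∼a a∼a deg1≤k
lemma3p2 (suc (suc _)) (suc zero) _ _ (s≤s ()) _ _ _ _ _ _ _ _ _ _
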